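{- For every $k\ge0$, the set $Sort^{(lg)}_k$ of permutations sorted by the left-greedy procedure on the $\mathfrak{D}^k\mathfrak{I}$ machine is a permutation class with basis $\{231\}$; that is, a permutation is sorted by the left-greedy procedure if and only if it avoids the pattern $231$.
   Context: The $\mathfrak{D}^k\mathfrak{I}$ machine consists of $k$ stacks $D_1,\dots,D_k$ in series (elements in decreasing order from top to bottom, top largest) followed by a stack $I$ (elements in increasing order from top to bottom, top smallest). The input permutation is read left to right. Operations: $d_0$: push the next input element into $D_1$ (into $I$ if $k=0$); $d_i$ ($1\le i\le k-1$): pop from $D_i$ and push into $D_{i+1}$; $d_k$: pop from $D_k$ and push into $I$; $d_{k+1}$: pop from $I$ and append to the output. An operation is legal if it respects the stack order restrictions; $d_{k+1}$ is considered legal if it outputs the smallest element not yet output, or if no other operation is legal. The left-greedy procedure, at each step, performs the legal operation $d_j$ with the largest index $j$ (priority $d_{k+1}\rhd d_k\rhd\cdots\rhd d_1\rhd d_0$). A permutation of length $n$ is sorted by it if the resulting output is $12\cdots n$. A permutation avoids $231$ if it has no indices $i<j<l$ with $\pi_l<\pi_i<\pi_j$. -}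

module Defs where

open import Data.Nat using (ℕ; zero; suc; _<ᵇ_; _≤ᵇ_)
open import Data.Bool using (Bool; true; false; if_then_else_; _∧_)
open import Data.List using (List; []; _∷_; _++_; [_]; concat; length; lookup; applyUpTo)
open import Data.Vec using (Vec; toList) renaming ([] to []ᵥ; _∷_ to _∷ᵥ_)
open import Data.Maybe using (Maybe; just; nothing)
open import Data.Product using (Σ; ∃; _×_; _,_)
open import Data.Fin using (Fin) renaming (_<_ to _<ᶠ_)
open import Data.Nat using () renaming (_<_ to _<ℕ_)
open import Relation.Nullary using (¬_)
open import Relation.Binary.PropositionalEquality using (_≡_)
open import Relation.Binary.Construct.Closure.ReflexiveTransitive using (Star)

-- Configuration of the D^k I machine.
-- Stacks are lists with the head being the top.
record State (k : ℕ) : Set where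
  constructor ⟨_,_,_,_⟩
  field
    input  : List ℕ
    dstack : Vec (List ℕ) k  -- D_1, ..., D_k
    istack : List ℕ
    output : List ℕ
open State public

pushD? : ℕ → List ℕ → Bool
pushD? x []      = true
pushD? x (y ∷ _) = y <ᵇ x

pushI? : ℕ → List ℕ → Bool
pushI? x []      = true
pushI? x (y ∷ _) = x <ᵇ y

-- Among the operations d_1, ..., d_k (moving the top of D_i to D_{i+1},
-- resp. of D_k to I), perform the legal one of largest index, if any.
-- Arguments: the stacks D_1..D_k and the stack I.
innerMove : ∀ {k} → Vec (List ℕ) k → List ℕ → Maybe (Vec (List ℕ) k × List ℕ)
innerMove []ᵥ I = nothing
innerMove (D ∷ᵥ rest) I with innerMove rest I
... | just (rest' , I') = just (D ∷ᵥ rest' , I')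
innerMove (D ∷ᵥ []ᵥ) I | nothing with D
... | []     = nothing
... | x ∷ D' = if pushI? x I then just (D' ∷ᵥ []ᵥ , x ∷ I) else nothing
innerMove (D ∷ᵥ (E ∷ᵥ rest)) I | nothing with D
... | []     = nothing
... | x ∷ D' = if pushD? x E then just (D' ∷ᵥ (x ∷ E) ∷ᵥ rest , I) else nothing

-- The operation d_0: push the next input element into D_1 (into I if k = 0).
pushMove : ∀ {k} → ℕ → Vec (List ℕ) k → List ℕ → Maybe (Vec (List ℕ) k × List ℕ)
pushMove x []ᵥ I = if pushI? x I then just ([]ᵥ , x ∷ I) else nothing
pushMove x (D ∷ᵥ rest) I = if pushD? x D then just ((x ∷ D) ∷ᵥ rest , I) else nothing

remaining : ∀ {k} → State k → List ℕ
remaining s = input s ++ concat (toList (dstack s)) ++ istack s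

isSmallest : ∀ {k} → ℕ → State k → Bool
isSmallest x s = allLe (remaining s)
  where
  allLe : List ℕ → Bool
  allLe [] = true
  allLe (y ∷ ys) = (x ≤ᵇ y) ∧ allLe ys

-- One step of the left-greedy procedure (priority d_{k+1} ▷ d_k ▷ ... ▷ d_0);
-- nothing if no operation is legal (the procedure halts).
stepD0 : ∀ {k} → State k → Maybe (State k)
stepD0 ⟨ [] , ds , I , out ⟩ = nothing
stepD0 ⟨ x ∷ inp , ds , I , out ⟩ with pushMove x ds I
... | just (ds' , I') = just ⟨ inp , ds' , I' , out ⟩
... | nothing = nothing

fallbackOut : ∀ {k} → State k → Maybe (State k)
fallbackOut ⟨ inp , ds , [] , out ⟩ = nothing
fallbackOut ⟨ inp , ds , x ∷ I , out ⟩ = just ⟨ inp , ds , I , out ++ [ x ] ⟩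

stepLowers : ∀ {k} → State k → Maybe (State k)
stepLowers s with innerMove (dstack s) (istack s)
... | just (ds' , I') = just ⟨ input s , ds' , I' , output s ⟩
... | nothing with stepD0 s
...   | just s' = just s'
...   | nothing = fallbackOut s

step : ∀ {k} → State k → Maybe (State k)
step s with istack s
... | [] = stepLowers s
... | x ∷ I with isSmallest x s
...   | true  = just ⟨ input s , dstack s , I , output s ++ [ x ] ⟩
...   | false = stepLowers s

initial : (k : ℕ) → List ℕ → State k
initial k π = ⟨ π , Data.Vec.replicate k [] , [] , [] ⟩

Step : ∀ {k} → State k → State k → Set
Step s s' = step s ≡ just s'

SortedLG : ℕ → List ℕ → Set
SortedLG k π = ∃ λ s → Star Step (initial k π) s × step s ≡ nothing
                       × output s ≡ applyUpTo suc (length π)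

Contains231 : List ℕ → Set
Contains231 π = Σ (Fin (length π)) λ i → Σ (Fin (length π)) λ j → Σ (Fin (length π)) λ l →
  i <ᶠ j × j <ᶠ l × lookup π l <ℕ lookup π i × lookup π i <ℕ lookup π j

Avoids231 : List ℕ → Set
Avoids231 π = ¬ Contains231 π

module Submission where

-- Treat the input as a zeroth D stack.  Then every step either outputs the
-- top of I or moves the top of one stack to the next (InnerStep).  On the
-- word `upstream` of elements not yet in I, ordered as they can reach I,
-- such a move is an Advance: some x overtakes a block of smaller elements,
-- or the first element enters I.  A weight drops at every step, so the
-- procedure always halts, and it halts only on an empty machine.
--
-- Everything revolves around a Block: a in I while b precedes c upstream,
-- with c < a ≤ b.  Advances preserve blocks, so a leaves before c and the
-- output is not increasing (block-doom); and the procedure is stuck with a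
-- top of I that is not the smallest remaining element only because of a
-- block (jammed-block, forced-block).
--   * Sorted ⇒ avoids: for a 231 pattern a … b … c, the state in which b is
--     read contains a block (sorted⇒avoids).
--   * Avoids ⇒ sorted: for 231-avoiding π a block yields a 231 pattern, so
--     the D stacks never hold two elements and only the smallest remaining
--     element is output (module AvoidingRun).

open import Defs
open import Data.Bool using (Bool; true; false; T; _∧_)
open import Data.Empty using (⊥; ⊥-elim)
open import Data.Fin using (Fin; toℕ) renaming (zero to fzero; suc to fsuc)
open import Data.List using (List; []; _∷_; _++_; [_]; concat; length; lookup; applyUpTo)
import Data.List.Properties as List
open import Data.List.Membership.Propositional using (_∈_)
open import Data.List.Membership.Propositional.Properties using (∈-++⁺ˡ; ∈-++⁺ʳ; ∈-++⁻; ∈-lookup)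
open import Data.List.Relation.Binary.Permutation.Propositional
  using (_↭_; ↭-refl; ↭-sym; ↭-trans; ↭-prep; ↭-reflexive; ↭⇒↭ₛ)
import Data.List.Relation.Binary.Permutation.Propositional.Properties as Perm
open import Data.List.Relation.Binary.Permutation.Setoid.Properties using (Unique-resp-↭)
open import Data.List.Relation.Binary.Subset.Propositional using (_⊆_)
open import Data.List.Relation.Unary.All as All using (All; []; _∷_)
open import Data.List.Relation.Unary.AllPairs as AllPairs using (AllPairs; []; _∷_)
open import Data.List.Relation.Unary.AllPairs.Properties using (applyUpTo⁺₁)
open import Data.List.Relation.Unary.Any using (here; there; index)
open import Data.List.Relation.Unary.Any.Properties using (lookup-index)
open import Data.List.Relation.Unary.Unique.Propositional using (Unique)
open import Data.Maybe using (just; nothing)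
open import Data.Nat using (ℕ; zero; suc; _+_; _*_; _≤_; _<_; _>_; z≤n; s≤s; s≤s⁻¹; _<ᵇ_; _≤ᵇ_)
open import Data.Nat.Properties
  using (<ᵇ⇒<; <⇒<ᵇ; ≤ᵇ⇒≤; ≤⇒≤ᵇ; ≮⇒≥; ≰⇒>; <⇒≢; <⇒≤; ≤∧≢⇒<;
         <-trans; <-irrefl; <-asym; <-≤-trans; ≤-trans; ≤-refl; +-suc; +-assoc; n<1+n)
open import Data.Nat.Tactic.RingSolver using (solve-∀)
open import Data.Product using (Σ; _×_; _,_; proj₁; proj₂)
open import Data.Sum using (_⊎_; inj₁; inj₂)
open import Data.Unit using (tt)
open import Data.Vec using (Vec; toList; replicate) renaming ([] to []ᵥ; _∷_ to _∷ᵥ_)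
import Data.Vec.Relation.Unary.All as VAll
open import Function.Bundles using (_⇔_; mk⇔)
open import Relation.Binary.Construct.Closure.ReflexiveTransitive using (Star; ε; _◅_)
open import Relation.Binary.PropositionalEquality
  using (_≡_; _≢_; refl; sym; trans; cong; cong₂; subst; subst₂; setoid; module ≡-Reasoning)

<ᵇ-true : ∀ {m n} → (m <ᵇ n) ≡ true → m < n
<ᵇ-true {m} {n} e = <ᵇ⇒< m n (subst T (sym e) tt)

<ᵇ-false : ∀ {m n} → (m <ᵇ n) ≡ false → n ≤ m
<ᵇ-false e = ≮⇒≥ λ m<n → subst T e (<⇒<ᵇ m<n)

AllPairs-across : ∀ {R : ℕ → ℕ → Set} A {B : List ℕ} {a c} →
                  AllPairs R (A ++ B) → a ∈ A → c ∈ B → R a c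
AllPairs-across (_ ∷ A) (a<A++B ∷ _) (here refl) c∈B = All.lookup a<A++B (∈-++⁺ʳ A c∈B)
AllPairs-across (_ ∷ A) (_ ∷ pairs) (there a∈A) c∈B = AllPairs-across A pairs a∈A c∈B

AllPairs-suffix : ∀ {R : ℕ → ℕ → Set} A {B : List ℕ} → AllPairs R (A ++ B) → AllPairs R B
AllPairs-suffix [] pairs = pairs
AllPairs-suffix (_ ∷ A) (_ ∷ pairs) = AllPairs-suffix A pairs

least-head : ∀ {L : List ℕ} {x} → AllPairs _<_ L → x ∈ L → All (x ≤_) L →
             Σ (List ℕ) λ L' → L ≡ x ∷ L'
least-head {_ ∷ L'} _ (here refl) _ = L' , refl
least-head ((y<L' ∷ _)) (there x∈L') (x≤y ∷ _) =
  ⊥-elim (<-irrefl refl (<-≤-trans (All.lookup y<L' x∈L') x≤y))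

Unique-disjoint : ∀ A {B : List ℕ} {a} → Unique (A ++ B) → a ∈ A → a ∈ B → ⊥
Unique-disjoint A u a∈A a∈B = AllPairs-across A u a∈A a∈B refl

ascending : ∀ n → AllPairs _<_ (applyUpTo suc n)
ascending n = applyUpTo⁺₁ suc n (λ i<j _ → s≤s i<j)

permutation-unique : ∀ {π n} → π ↭ applyUpTo suc n → Unique π
permutation-unique {n = n} π↭ =
  Unique-resp-↭ (setoid ℕ) (↭⇒↭ₛ (↭-sym π↭)) (AllPairs.map <⇒≢ (ascending n))

data Before (b c : ℕ) : List ℕ → Set where
  atHead : ∀ {L} → c ∈ L → Before b c (b ∷ L)
  later  : ∀ {y L} → Before b c L → Before b c (y ∷ L)

Before-∈ˡ : ∀ {b c L} → Before b c L → b ∈ L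
Before-∈ˡ (atHead _) = here refl
Before-∈ˡ (later p) = there (Before-∈ˡ p)

Before-∈ʳ : ∀ {b c L} → Before b c L → c ∈ L
Before-∈ʳ (atHead c∈L) = there c∈L
Before-∈ʳ (later p) = there (Before-∈ʳ p)

Before-prefix : ∀ {b c} A {L} → Before b c L → Before b c (A ++ L)
Before-prefix [] p = p
Before-prefix (_ ∷ A) p = later (Before-prefix A p)

Before-suffix : ∀ {b c L} M → Before b c L → Before b c (L ++ M)
Before-suffix M (atHead c∈L) = atHead (∈-++⁺ˡ c∈L)
Before-suffix M (later p) = later (Before-suffix M p)

Before-++ : ∀ {b c} {A : List ℕ} B → b ∈ A → c ∈ B → Before b c (A ++ B)
Before-++ {A = _ ∷ A} B (here refl) c∈B = atHead (∈-++⁺ʳ A c∈B)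
Before-++ {A = _ ∷ A} B (there b∈A) c∈B = later (Before-++ B b∈A c∈B)

Before-split : ∀ {b c} A {B} → Before b c (A ++ B) →
               Before b c A ⊎ (b ∈ A × c ∈ B) ⊎ Before b c B
Before-split [] p = inj₂ (inj₂ p)
Before-split (_ ∷ A) (atHead c∈A++B) with ∈-++⁻ A c∈A++B
... | inj₁ c∈A = inj₁ (atHead c∈A)
... | inj₂ c∈B = inj₂ (inj₁ (here refl , c∈B))
Before-split (_ ∷ A) (later p) with Before-split A p
... | inj₁ q = inj₁ (later q)
... | inj₂ (inj₁ (b∈A , c∈B)) = inj₂ (inj₁ (there b∈A , c∈B))
... | inj₂ (inj₂ q) = inj₂ (inj₂ q)

Before-positions : ∀ {b c L} → Before b c L →
  Σ (Fin (length L)) λ j → Σ (Fin (length L)) λ l →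
    toℕ j < toℕ l × lookup L j ≡ b × lookup L l ≡ c
Before-positions (atHead c∈L) = fzero , fsuc (index c∈L) , s≤s z≤n , refl , sym (lookup-index c∈L)
Before-positions (later p) with Before-positions p
... | j , l , j<l , Lj , Ll = fsuc j , fsuc l , s≤s j<l , Lj , Ll

pattern231 : ∀ A {B a b c} → a ∈ A → Before b c B → c < a → a < b → Contains231 (A ++ B)
pattern231 (_ ∷ A) {B} (here refl) bc c<a a<b with Before-positions (Before-prefix A bc)
... | j , l , j<l , refl , refl = fzero , fsuc j , fsuc l , s≤s z≤n , s≤s j<l , c<a , a<b
pattern231 (_ ∷ A) (there a∈A) bc c<a a<b with pattern231 A a∈A bc c<a a<b
... | i , j , l , i<j , j<l , lt₁ , lt₂ = fsuc i , fsuc j , fsuc l , s≤s i<j , s≤s j<l , lt₁ , lt₂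

record Occurrence231 (π : List ℕ) : Set where
  constructor occurrence
  field
    A post : List ℕ
    a b c : ℕ
    split : π ≡ A ++ b ∷ post
    a∈A : a ∈ A
    c∈post : c ∈ post
    c<a : c < a
    a<b : a < b

later-position : ∀ (π : List ℕ) (j l : Fin (length π)) → toℕ j < toℕ l →
  Σ (List ℕ) λ A → Σ (List ℕ) λ post → π ≡ A ++ lookup π j ∷ post × lookup π l ∈ post
later-position (y ∷ π) fzero (fsuc l) _ = [] , π , refl , ∈-lookup l
later-position (y ∷ π) (fsuc j) (fsuc l) (s≤s j<l) with later-position π j l j<l
... | A , post , π≡ , l∈post = y ∷ A , post , cong (y ∷_) π≡ , l∈post

occurrence231 : ∀ π → Contains231 π → Occurrence231 π
occurrence231 (y ∷ π) (fzero , fsuc j , fsuc l , _ , s≤s j<l , lt₁ , lt₂) with later-position π j l j<l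
... | A , post , π≡ , l∈post =
  occurrence (y ∷ A) post y (lookup π j) (lookup π l) (cong (y ∷_) π≡) (here refl) l∈post lt₁ lt₂
occurrence231 (y ∷ π) (fsuc i , fsuc j , fsuc l , s≤s i<j , s≤s j<l , lt₁ , lt₂)
  with occurrence231 π (i , j , l , i<j , j<l , lt₁ , lt₂)
... | occurrence A post a b c π≡ a∈A c∈post c<a a<b =
  occurrence (y ∷ A) post a b c (cong (y ∷_) π≡) (there a∈A) c∈post c<a a<b

Decreasing Increasing : List ℕ → Set
Decreasing = AllPairs _>_
Increasing = AllPairs _<_

DSorted : ∀ {k} → Vec (List ℕ) k → Set
DSorted = VAll.All Decreasing

StacksSorted : ∀ {k} → State k → Set
StacksSorted s = DSorted (dstack s) × Increasing (istack s)

-- The contents of D_k, ..., D_1 (each read top first): the order in which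
-- these elements can reach I.
dContents : ∀ {k} → Vec (List ℕ) k → List ℕ
dContents []ᵥ = []
dContents (D ∷ᵥ rest) = dContents rest ++ D

-- Everything that has not yet entered I, in the order it can enter I.
upstream : ∀ {k} → State k → List ℕ
upstream s = dContents (dstack s) ++ input s

-- An element of the i-th stack of a sequence of m stacks still needs
-- m + 1 - i operations to be output; the weight counts these operations.
dWeight : ∀ {k} → Vec (List ℕ) k → ℕ
dWeight []ᵥ = 0
dWeight {suc m} (D ∷ᵥ rest) = length D * (m + 2) + dWeight rest

-- The input behaves as a zeroth D stack.
weight : ∀ {k} → State k → ℕ
weight s = dWeight (input s ∷ᵥ dstack s) + length (istack s)

pushD-below : ∀ {x E} → pushD? x E ≡ true → Decreasing E → All (_< x) E
pushD-below {E = []} _ _ = []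
pushD-below {E = y ∷ E} p (y>E ∷ _) =
  <ᵇ-true p ∷ All.map (λ z<y → <-trans z<y (<ᵇ-true p)) y>E

data InnerStep : ∀ {k} → Vec (List ℕ) k → List ℕ → Vec (List ℕ) k → List ℕ → Set where
  toI    : ∀ {x D I} → pushI? x I ≡ true →
           InnerStep ((x ∷ D) ∷ᵥ []ᵥ) I (D ∷ᵥ []ᵥ) (x ∷ I)
  across : ∀ {k x D E I} {rest : Vec (List ℕ) k} → pushD? x E ≡ true →
           InnerStep ((x ∷ D) ∷ᵥ E ∷ᵥ rest) I (D ∷ᵥ (x ∷ E) ∷ᵥ rest) I
  deeper : ∀ {k D I I'} {ds ds' : Vec (List ℕ) k} →
           InnerStep ds I ds' I' → InnerStep (D ∷ᵥ ds) I (D ∷ᵥ ds') I'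

innerMove-sound : ∀ {k} (ds : Vec (List ℕ) k) I {ds' I'} →
                  innerMove ds I ≡ just (ds' , I') → InnerStep ds I ds' I'
innerMove-sound []ᵥ I ()
innerMove-sound (D ∷ᵥ rest) I eq with innerMove rest I in e
innerMove-sound (D ∷ᵥ rest) I refl | just _ = deeper (innerMove-sound rest I e)
innerMove-sound (D ∷ᵥ []ᵥ) I eq | nothing with D
innerMove-sound (D ∷ᵥ []ᵥ) I () | nothing | []
innerMove-sound (D ∷ᵥ []ᵥ) I eq | nothing | x ∷ D' with pushI? x I in p
innerMove-sound (D ∷ᵥ []ᵥ) I refl | nothing | x ∷ D' | true = toI p
innerMove-sound (D ∷ᵥ []ᵥ) I () | nothing | x ∷ D' | false
innerMove-sound (D ∷ᵥ E ∷ᵥ rest) I eq | nothing with D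
innerMove-sound (D ∷ᵥ E ∷ᵥ rest) I () | nothing | []
innerMove-sound (D ∷ᵥ E ∷ᵥ rest) I eq | nothing | x ∷ D' with pushD? x E in p
innerMove-sound (D ∷ᵥ E ∷ᵥ rest) I refl | nothing | x ∷ D' | true = across p
innerMove-sound (D ∷ᵥ E ∷ᵥ rest) I () | nothing | x ∷ D' | false

pushMove-sound : ∀ {k} x (ds : Vec (List ℕ) k) I {ds' I'} →
                 pushMove x ds I ≡ just (ds' , I') → InnerStep ([ x ] ∷ᵥ ds) I ([] ∷ᵥ ds') I'
pushMove-sound x []ᵥ I eq with pushI? x I in p
pushMove-sound x []ᵥ I refl | true = toI p
pushMove-sound x []ᵥ I () | false
pushMove-sound x (D ∷ᵥ rest) I eq with pushD? x D in p
pushMove-sound x (D ∷ᵥ rest) I refl | true = across p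
pushMove-sound x (D ∷ᵥ rest) I () | false

innerStep-extend : ∀ {k D D' I I'} M {ds ds' : Vec (List ℕ) k} →
  InnerStep (D ∷ᵥ ds) I (D' ∷ᵥ ds') I' → InnerStep ((D ++ M) ∷ᵥ ds) I ((D' ++ M) ∷ᵥ ds') I'
innerStep-extend M (toI p) = toI p
innerStep-extend M (across p) = across p
innerStep-extend M (deeper st) = deeper st

innerStep-weight : ∀ {k I I'} {ds ds' : Vec (List ℕ) k} → InnerStep ds I ds' I' →
                   suc (dWeight ds' + length I') ≡ dWeight ds + length I
innerStep-weight {I = I} (toI {D = D} _) = into-I (length D) (length I)
  where
  into-I : ∀ d i → suc (d * 2 + 0 + suc i) ≡ suc d * 2 + 0 + i
  into-I = solve-∀
innerStep-weight {suc (suc m)} {I} (across {D = D} {E} {rest = rest} _) =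
  one-level (length D) (length E) (dWeight rest) m (length I)
  where
  one-level : ∀ d e r m i →
    suc (d * (suc m + 2) + (suc e * (m + 2) + r) + i) ≡ suc d * (suc m + 2) + (e * (m + 2) + r) + i
  one-level = solve-∀
innerStep-weight {suc m} {I} {I'} (deeper {D = D} {ds = ds} {ds'} st) =
  begin
    suc (a + dWeight ds' + length I')  ≡⟨ cong suc (+-assoc a _ _) ⟩
    suc (a + (dWeight ds' + length I')) ≡⟨ sym (+-suc a _) ⟩
    a + suc (dWeight ds' + length I')   ≡⟨ cong (a +_) (innerStep-weight st) ⟩
    a + (dWeight ds + length I)         ≡⟨ sym (+-assoc a _ _) ⟩
    a + dWeight ds + length I           ∎
  where
  open ≡-Reasoning
  a = length D * (m + 2)

innerStep-sorted : ∀ {k I I'} {ds ds' : Vec (List ℕ) k} → InnerStep ds I ds' I' →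
                   DSorted ds → DSorted ds'
innerStep-sorted (toI _) ((_ ∷ sD) VAll.∷ VAll.[]) = sD VAll.∷ VAll.[]
innerStep-sorted (across p) ((_ ∷ sD) VAll.∷ sE VAll.∷ sRest) =
  sD VAll.∷ (pushD-below p sE ∷ sE) VAll.∷ sRest
innerStep-sorted (deeper st) (sD VAll.∷ sds) = sD VAll.∷ innerStep-sorted st sds

-- The effect of a move on the word of elements waiting to enter I:
-- either some x overtakes a block Q of smaller elements (moving one
-- stack closer to I), or the first element x enters I.
data Advance (F I F' I' : List ℕ) : Set where
  overtake : ∀ P Q x R → F ≡ P ++ Q ++ x ∷ R → F' ≡ P ++ x ∷ Q ++ R → I' ≡ I →
             All (_< x) Q → Advance F I F' I'
  enter    : ∀ x → F ≡ x ∷ F' → I' ≡ x ∷ I → pushI? x I ≡ true → Advance F I F' I'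

Advance-++ : ∀ {F I F' I'} M → Advance F I F' I' → Advance (F ++ M) I (F' ++ M) I'
Advance-++ M (overtake P Q x R refl refl I'≡ Q<x) =
  overtake P Q x (R ++ M)
    (trans (List.++-assoc P (Q ++ x ∷ R) M) (cong (P ++_) (List.++-assoc Q (x ∷ R) M)))
    (trans (List.++-assoc P (x ∷ Q ++ R) M) (cong (λ z → P ++ x ∷ z) (List.++-assoc Q R M)))
    I'≡ Q<x
Advance-++ M (enter x refl I'≡ p) = enter x refl I'≡ p

innerStep-advance : ∀ {k I I'} {ds ds' : Vec (List ℕ) k} → InnerStep ds I ds' I' → DSorted ds →
                    Advance (dContents ds) I (dContents ds') I'
innerStep-advance (toI p) _ = enter _ refl refl p
innerStep-advance (across {x = x} {D} {E} {rest = rest} p) (_ VAll.∷ sE VAll.∷ _) =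
  overtake (dContents rest) E x D (List.++-assoc (dContents rest) E (x ∷ D))
           (List.++-assoc (dContents rest) (x ∷ E) D) refl (pushD-below p sE)
innerStep-advance (deeper {D = D} st) (_ VAll.∷ sds) = Advance-++ D (innerStep-advance st sds)

Advance-perm : ∀ {F I F' I'} → Advance F I F' I' → F' ++ I' ↭ F ++ I
Advance-perm {I = I} (overtake P Q x R refl refl refl _) =
  Perm.++⁺ʳ I (Perm.++⁺ˡ P (↭-sym (Perm.shift x Q R)))
Advance-perm {I = I} (enter x refl refl _) = Perm.shift x _ I

Advance-increasing : ∀ {F I F' I'} → Advance F I F' I' → Increasing I → Increasing I'
Advance-increasing (overtake _ _ _ _ _ _ refl _) inc = inc
Advance-increasing {I = []} (enter x _ refl _) _ = [] ∷ []
Advance-increasing {I = t ∷ I} (enter x _ refl p) (t<I ∷ inc) =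
  (<ᵇ-true p ∷ All.map (<-trans (<ᵇ-true p)) t<I) ∷ t<I ∷ inc

∈-nonempty : ∀ {x : ℕ} {L} → x ∈ L → 0 < length L
∈-nonempty (here _) = s≤s z≤n
∈-nonempty (there _) = s≤s z≤n

∈-cons : ∀ {x : ℕ} {L} → x ∈ L → Σ ℕ λ y → Σ (List ℕ) λ L' → L ≡ y ∷ L'
∈-cons {L = y ∷ L'} _ = y , L' , refl

-- While D holds at most one element, an advance either changes nothing
-- or lets the first element enter I.
Simple : List ℕ → List ℕ → List ℕ → List ℕ → Set
Simple F I F' I' = (F' ≡ F × I' ≡ I) ⊎ (Σ ℕ λ x → F ≡ x ∷ F' × I' ≡ x ∷ I)

short-advance : ∀ {F I F' I'} → length F ≤ 1 → Advance F I F' I' → Simple F I F' I'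
short-advance short (overtake [] [] x [] refl refl I'≡ _) = inj₁ (refl , I'≡)
short-advance short (enter x F≡ I'≡ _) = inj₂ (x , F≡ , I'≡)
short-advance (s≤s ()) (overtake [] [] x (_ ∷ _) refl refl _ _)
short-advance (s≤s short) (overtake [] (_ ∷ Q) x R refl refl _ _) =
  ⊥-elim (<-irrefl refl (<-≤-trans (∈-nonempty (∈-++⁺ʳ Q (here refl))) short))
short-advance (s≤s short) (overtake (_ ∷ P) Q x R refl refl _ _) =
  ⊥-elim (<-irrefl refl (<-≤-trans (∈-nonempty (∈-++⁺ʳ P (∈-++⁺ʳ Q (here refl)))) short))

Simple-++ : ∀ {F I F' I'} M → Simple F I F' I' → Simple (F ++ M) I (F' ++ M) I'
Simple-++ M (inj₁ (F'≡ , I'≡)) = inj₁ (cong (_++ M) F'≡ , I'≡)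
Simple-++ M (inj₂ (x , F≡ , I'≡)) = inj₂ (x , cong (_++ M) F≡ , I'≡)

Simple-short : ∀ {F I F' I'} → length F ≤ 1 → Simple F I F' I' → length F' ≤ 1
Simple-short short (inj₁ (refl , _)) = short
Simple-short short (inj₂ (_ , refl , _)) = <⇒≤ short

shift-simple : ∀ {k I I'} {ds ds' : Vec (List ℕ) k} → DSorted ds → length (dContents ds) ≤ 1 →
               InnerStep ds I ds' I' → Simple (dContents ds) I (dContents ds') I'
shift-simple sD short st = short-advance short (innerStep-advance st sD)

read-simple : ∀ {k I I' x} {ds ds' : Vec (List ℕ) k} → DSorted ds → dContents ds ≡ [] →
              InnerStep ([ x ] ∷ᵥ ds) I ([] ∷ᵥ ds') I' → Simple [ x ] I (dContents ds') I'
read-simple {x = x} {ds' = ds'} sD empty st =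
  subst (λ F' → Simple [ x ] _ F' _) (List.++-identityʳ (dContents ds'))
        (short-advance (s≤s z≤n)
          (subst (λ F → Advance (F ++ [ x ]) _ _ _) empty (innerStep-advance st (([] ∷ []) VAll.∷ sD))))

-- Overtaking only smaller elements cannot bring c in front of a larger b.
Before-overtake : ∀ {b c} P Q x R → c < b → All (_< x) Q →
                  Before b c (P ++ Q ++ x ∷ R) → Before b c (P ++ x ∷ Q ++ R)
Before-overtake {b} {c} P Q x R c<b Q<x bc with Before-split P bc
... | inj₁ inP = Before-suffix (x ∷ Q ++ R) inP
... | inj₂ (inj₁ (b∈P , c∈rest)) =
  Before-++ (x ∷ Q ++ R) b∈P (Perm.∈-resp-↭ (Perm.shift x Q R) c∈rest)
... | inj₂ (inj₂ inRest) = Before-prefix P (moved inRest)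
  where
  moved : Before b c (Q ++ x ∷ R) → Before b c (x ∷ Q ++ R)
  moved p with Before-split Q p
  ... | inj₁ inQ = later (Before-suffix R inQ)
  ... | inj₂ (inj₁ (b∈Q , here refl)) = ⊥-elim (<-irrefl refl (<-trans c<b (All.lookup Q<x b∈Q)))
  ... | inj₂ (inj₁ (b∈Q , there c∈R)) = later (Before-++ R b∈Q c∈R)
  ... | inj₂ (inj₂ (atHead c∈R)) = atHead (∈-++⁺ʳ Q c∈R)
  ... | inj₂ (inj₂ (later q)) = later (Before-prefix Q q)

top-least : ∀ {t I a} → Increasing (t ∷ I) → a ∈ t ∷ I → t ≤ a
top-least _ (here refl) = ≤-refl
top-least (t<I ∷ _) (there a∈I) = <⇒≤ (All.lookup t<I a∈I)

-- The configuration "a in I, and b before c upstream, with c < a ≤ b"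
-- survives every advance: b cannot enter I above a, and c cannot
-- overtake b.
Advance-block : ∀ {F I F' I' a b c} → Increasing I → Advance F I F' I' →
                a ∈ I → Before b c F → c < a → a ≤ b → a ∈ I' × Before b c F'
Advance-block _ (overtake P Q x R refl refl refl Q<x) a∈I bc c<a a≤b =
  a∈I , Before-overtake P Q x R (<-≤-trans c<a a≤b) Q<x bc
Advance-block _ (enter x refl refl _) a∈I (later bc) _ _ = there a∈I , bc
Advance-block {I = t ∷ I} inc (enter x refl refl p) a∈I (atHead _) _ a≤b =
  ⊥-elim (<-irrefl refl (<-≤-trans (<ᵇ-true p) (≤-trans (top-least inc a∈I) a≤b)))

NotSmallTop : ∀ {k} → State k → Set
NotSmallTop s = ∀ {t I} → istack s ≡ t ∷ I → isSmallest t s ≡ false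

NoRead : ∀ {k} → State k → Set
NoRead s = ∀ {x inp} → input s ≡ x ∷ inp → pushMove x (dstack s) (istack s) ≡ nothing

data StepCase {k} (s : State k) : State k → Set where
  emitSmallest : ∀ {x I} → istack s ≡ x ∷ I → isSmallest x s ≡ true →
                 StepCase s ⟨ input s , dstack s , I , output s ++ [ x ] ⟩
  emitForced   : ∀ {x I} → istack s ≡ x ∷ I → isSmallest x s ≡ false →
                 innerMove (dstack s) (istack s) ≡ nothing → NoRead s →
                 StepCase s ⟨ input s , dstack s , I , output s ++ [ x ] ⟩
  shift        : ∀ {ds' I'} → InnerStep (dstack s) (istack s) ds' I' →
                 StepCase s ⟨ input s , ds' , I' , output s ⟩
  read         : ∀ {x inp ds' I'} → input s ≡ x ∷ inp →
                 innerMove (dstack s) (istack s) ≡ nothing → NotSmallTop s →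
                 InnerStep ([ x ] ∷ᵥ dstack s) (istack s) ([] ∷ᵥ ds') I' →
                 StepCase s ⟨ inp , ds' , I' , output s ⟩

stepD0-fails : ∀ {k} (s : State k) → stepD0 s ≡ nothing → NoRead s
stepD0-fails ⟨ x ∷ inp , ds , I , out ⟩ d0 refl with pushMove x ds I
stepD0-fails ⟨ x ∷ inp , ds , I , out ⟩ () refl | just _
stepD0-fails ⟨ x ∷ inp , ds , I , out ⟩ d0 refl | nothing = refl

decode-read : ∀ {k} (s : State k) {s'} → innerMove (dstack s) (istack s) ≡ nothing →
             NotSmallTop s → stepD0 s ≡ just s' → StepCase s s'
decode-read ⟨ [] , ds , I , out ⟩ _ _ ()
decode-read ⟨ x ∷ inp , ds , I , out ⟩ im nst eq with pushMove x ds I in p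
decode-read ⟨ x ∷ inp , ds , I , out ⟩ im nst refl | just _ = read refl im nst (pushMove-sound x ds I p)
decode-read ⟨ x ∷ inp , ds , I , out ⟩ im nst () | nothing

decode-forced : ∀ {k} (s : State k) {s'} → innerMove (dstack s) (istack s) ≡ nothing →
               stepD0 s ≡ nothing → NotSmallTop s → fallbackOut s ≡ just s' → StepCase s s'
decode-forced ⟨ inp , ds , [] , out ⟩ _ _ _ ()
decode-forced ⟨ inp , ds , x ∷ I , out ⟩ im d0 nst refl = emitForced refl (nst refl) im (stepD0-fails _ d0)

decode-lowers : ∀ {k} (s : State k) {s'} → NotSmallTop s → stepLowers s ≡ just s' → StepCase s s'
decode-lowers s nst eq with innerMove (dstack s) (istack s) in im
decode-lowers ⟨ inp , ds , I , out ⟩ nst refl | just _ = shift (innerMove-sound ds I im)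
decode-lowers s nst eq | nothing with stepD0 s in d0
... | just _ = decode-read s im nst (trans d0 eq)
... | nothing = decode-forced s im d0 nst eq

decode : ∀ {k} (s : State k) {s'} → step s ≡ just s' → StepCase s s'
decode ⟨ inp , ds , [] , out ⟩ eq = decode-lowers _ (λ ()) eq
decode ⟨ inp , ds , x ∷ I , out ⟩ eq with isSmallest x ⟨ inp , ds , x ∷ I , out ⟩ in sm
decode ⟨ inp , ds , x ∷ I , out ⟩ refl | true = emitSmallest refl sm
decode ⟨ inp , ds , x ∷ I , out ⟩ eq | false = decode-lowers _ (λ { refl → sm }) eq

Obstructed : List ℕ → List ℕ → Set
Obstructed F I = Σ ℕ λ e → Σ (List ℕ) λ R → Σ ℕ λ t → Σ (List ℕ) λ I' →
                 F ≡ e ∷ R × I ≡ t ∷ I' × t ≤ e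

innerMove-stuck : ∀ {k} (ds : Vec (List ℕ) k) I → innerMove ds I ≡ nothing →
                  dContents ds ≡ [] ⊎ Obstructed (dContents ds) I
innerMove-stuck []ᵥ I _ = inj₁ refl
innerMove-stuck (D ∷ᵥ rest) I eq with innerMove rest I in e
innerMove-stuck (D ∷ᵥ rest) I () | just _
innerMove-stuck (D ∷ᵥ []ᵥ) I eq | nothing with D
... | [] = inj₁ refl
... | x ∷ D' with pushI? x I in p
innerMove-stuck (D ∷ᵥ []ᵥ) I () | nothing | x ∷ D' | true
innerMove-stuck (D ∷ᵥ []ᵥ) [] eq | nothing | x ∷ D' | false with () ← p
innerMove-stuck (D ∷ᵥ []ᵥ) (t ∷ I) eq | nothing | x ∷ D' | false =
  inj₂ (x , D' , t , I , refl , refl , <ᵇ-false p)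
innerMove-stuck (D ∷ᵥ E ∷ᵥ rest) I eq | nothing with D | innerMove-stuck (E ∷ᵥ rest) I e
... | [] | stuck = subst (λ F → F ≡ [] ⊎ Obstructed F I) (sym (List.++-identityʳ _)) stuck
... | x ∷ D' | stuck with pushD? x E in p
innerMove-stuck (D ∷ᵥ E ∷ᵥ rest) I () | nothing | x ∷ D' | stuck | true
innerMove-stuck (D ∷ᵥ E ∷ᵥ rest) I eq | nothing | x ∷ D' | inj₁ empty | false
  with () ← trans (sym p) (cong (pushD? x) (List.++-conicalʳ (dContents rest) E empty))
innerMove-stuck (D ∷ᵥ E ∷ᵥ rest) I eq | nothing | x ∷ D'
  | inj₂ (e , R , t , I' , F≡ , I≡ , t≤e) | false =
  inj₂ (e , R ++ x ∷ D' , t , I' , cong (_++ x ∷ D') F≡ , I≡ , t≤e)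

pushMove-stuck : ∀ {k} x (ds : Vec (List ℕ) k) I → dContents ds ≡ [] → pushMove x ds I ≡ nothing →
                 Σ ℕ λ t → Σ (List ℕ) λ I' → I ≡ t ∷ I' × t ≤ x
pushMove-stuck x []ᵥ I _ eq with pushI? x I in p
pushMove-stuck x []ᵥ I _ () | true
pushMove-stuck x []ᵥ [] _ eq | false with () ← p
pushMove-stuck x []ᵥ (t ∷ I) _ eq | false = t , I , refl , <ᵇ-false p
pushMove-stuck x ((y ∷ D) ∷ᵥ rest) I empty eq with () ← List.++-conicalʳ (dContents rest) (y ∷ D) empty
pushMove-stuck x ([] ∷ᵥ rest) I empty ()

concat-dContents : ∀ {k} (ds : Vec (List ℕ) k) → concat (toList ds) ↭ dContents ds
concat-dContents []ᵥ = ↭-refl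
concat-dContents (D ∷ᵥ rest) =
  ↭-trans (Perm.++⁺ˡ D (concat-dContents rest)) (Perm.++-comm D (dContents rest))

remaining-split : ∀ {k} (s : State k) → remaining s ↭ upstream s ++ istack s
remaining-split ⟨ inp , ds , I , out ⟩ =
  ↭-trans (Perm.++⁺ˡ inp (Perm.++⁺ʳ I (concat-dContents ds)))
    (↭-trans (↭-sym (Perm.++-assoc inp (dContents ds) I)) (Perm.++⁺ʳ I (Perm.++-comm inp (dContents ds))))

allAtLeast : ℕ → List ℕ → Bool
allAtLeast x [] = true
allAtLeast x (y ∷ ys) = (x ≤ᵇ y) ∧ allAtLeast x ys

-- isSmallest depends on the state only through remaining s, so it can be
-- computed on the state whose only nonempty stack is that list.
isSmallest-on : ∀ x I → isSmallest {0} x ⟨ [] , []ᵥ , I , [] ⟩ ≡ allAtLeast x I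
isSmallest-on x [] = refl
isSmallest-on x (y ∷ I) = cong ((x ≤ᵇ y) ∧_) (isSmallest-on x I)

isSmallest-unfold : ∀ {k} x (s : State k) → isSmallest x s ≡ allAtLeast x (remaining s)
isSmallest-unfold x s = isSmallest-on x (remaining s)

allAtLeast-true : ∀ x ys → allAtLeast x ys ≡ true → All (x ≤_) ys
allAtLeast-true x [] _ = []
allAtLeast-true x (y ∷ ys) h with x ≤ᵇ y in x≤y
... | true = ≤ᵇ⇒≤ x y (subst T (sym x≤y) tt) ∷ allAtLeast-true x ys h

allAtLeast-false : ∀ x ys → allAtLeast x ys ≡ false → Σ ℕ λ y → y ∈ ys × y < x
allAtLeast-false x (y ∷ ys) h with x ≤ᵇ y in x≤y
... | false = y , here refl , ≰⇒> (λ x≤y' → subst T x≤y (≤⇒≤ᵇ x≤y'))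
... | true with allAtLeast-false x ys h
...   | z , z∈ys , z<x = z , there z∈ys , z<x

isSmallest-true : ∀ {k} {x} (s : State k) → isSmallest x s ≡ true → All (x ≤_) (remaining s)
isSmallest-true {x = x} s h = allAtLeast-true x (remaining s) (trans (sym (isSmallest-unfold x s)) h)

smaller-upstream : ∀ {k} (s : State k) {t I} → Increasing (istack s) → istack s ≡ t ∷ I →
                   isSmallest t s ≡ false → Σ ℕ λ m → m ∈ upstream s × m < t
smaller-upstream s {t} inc I≡ h
  with allAtLeast-false t (remaining s) (trans (sym (isSmallest-unfold t s)) h)
... | m , m∈rem , m<t with ∈-++⁻ (upstream s) (Perm.∈-resp-↭ (remaining-split s) m∈rem)
...   | inj₁ m∈up = m , m∈up , m<t
...   | inj₂ m∈I =
  ⊥-elim (<-irrefl refl (<-≤-trans m<t (top-least (subst Increasing I≡ inc) (subst (m ∈_) I≡ m∈I))))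

not-small-top : ∀ {k} {s : State k} {x I} → istack s ≡ x ∷ I → isSmallest x s ≡ false →
                NotSmallTop s
not-small-top I≡ notSmall I≡' with trans (sym I≡) I≡'
... | refl = notSmall

-- A blocking configuration: a sits in I while b precedes c upstream, with
-- c < a ≤ b.  Then b can never pass a, so c cannot be output after a.
data Block {k} (s : State k) : Set where
  block : ∀ {a b c} → a ∈ istack s → Before b c (upstream s) → c < a → a ≤ b → Block s

obstruction-block : ∀ {k} (s : State k) → StacksSorted s → NotSmallTop s →
                    Obstructed (upstream s) (istack s) → Block s
obstruction-block s (_ , inc) nst (e , R , t , I' , F≡ , I≡ , t≤e)
  with smaller-upstream s inc I≡ (nst I≡)
... | m , m∈F , m<t with subst (m ∈_) F≡ m∈F
...   | here refl = ⊥-elim (<-irrefl refl (<-≤-trans m<t t≤e))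
...   | there m∈R =
  block (subst (t ∈_) (sym I≡) (here refl)) (subst (Before e m) (sym F≡) (atHead m∈R)) m<t t≤e

jammed-block : ∀ {k} (s : State k) → StacksSorted s → NotSmallTop s →
               innerMove (dstack s) (istack s) ≡ nothing → dContents (dstack s) ≡ [] ⊎ Block s
jammed-block s sorted nst im with innerMove-stuck (dstack s) (istack s) im
... | inj₁ empty = inj₁ empty
... | inj₂ (e , R , t , I' , D≡ , I≡ , t≤e) =
  inj₂ (obstruction-block s sorted nst (e , R ++ input s , t , I' , cong (_++ input s) D≡ , I≡ , t≤e))

forced-block : ∀ {k} (s : State k) {x I} → StacksSorted s → istack s ≡ x ∷ I →
               isSmallest x s ≡ false → innerMove (dstack s) (istack s) ≡ nothing → NoRead s → Block s
forced-block s sorted I≡ notSmall im noRead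
  with jammed-block s sorted (not-small-top {s = s} I≡ notSmall) im
... | inj₂ blk = blk
... | inj₁ empty with smaller-upstream s (proj₂ sorted) I≡ notSmall
...   | m , m∈up , _ with ∈-cons (subst (m ∈_) (cong (_++ input s) empty) m∈up)
...     | y , inp , inp≡ with pushMove-stuck y (dstack s) (istack s) empty (noRead inp≡)
...       | t , I' , I≡' , t≤y =
  obstruction-block s sorted (not-small-top {s = s} I≡ notSmall)
    (y , inp , t , I' , cong₂ _++_ empty inp≡ , I≡' , t≤y)

halt-case : ∀ {k} (s : State k) → step s ≡ nothing →
           istack s ≡ [] × innerMove (dstack s) (istack s) ≡ nothing × NoRead s
halt-case ⟨ inp , ds , x ∷ I , out ⟩ h with isSmallest x ⟨ inp , ds , x ∷ I , out ⟩
halt-case ⟨ inp , ds , x ∷ I , out ⟩ () | true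
... | false with innerMove ds (x ∷ I)
halt-case ⟨ inp , ds , x ∷ I , out ⟩ () | false | just _
... | nothing with stepD0 ⟨ inp , ds , x ∷ I , out ⟩
halt-case ⟨ inp , ds , x ∷ I , out ⟩ () | false | nothing | just _
halt-case ⟨ inp , ds , x ∷ I , out ⟩ () | false | nothing | nothing
halt-case ⟨ inp , ds , [] , out ⟩ h with innerMove ds []
halt-case ⟨ inp , ds , [] , out ⟩ () | just _
... | nothing with stepD0 ⟨ inp , ds , [] , out ⟩ in d0
halt-case ⟨ inp , ds , [] , out ⟩ () | nothing | just _
... | nothing = refl , refl , stepD0-fails _ d0

halted : ∀ {k} (s : State k) → step s ≡ nothing → upstream s ≡ [] × istack s ≡ []
halted s h with halt-case s h
... | I≡ , im , noRead with innerMove-stuck (dstack s) (istack s) im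
...   | inj₂ (_ , _ , _ , _ , _ , I≡' , _) with () ← trans (sym I≡) I≡'
...   | inj₁ empty with input s
...     | [] = cong (_++ []) empty , I≡
...     | y ∷ inp with pushMove-stuck y (dstack s) (istack s) empty (noRead refl)
...       | _ , _ , I≡' , _ with () ← trans (sym I≡) I≡'

halted-empty : ∀ {k} (s : State k) → step s ≡ nothing → remaining s ↭ []
halted-empty s h with halted s h
... | up≡ , I≡ = ↭-trans (remaining-split s) (↭-reflexive (cong₂ _++_ up≡ I≡))

emit-weight : ∀ {k} (s : State k) {x I} → istack s ≡ x ∷ I →
              suc (weight ⟨ input s , dstack s , I , output s ++ [ x ] ⟩) ≡ weight s
emit-weight s {I = I} I≡ =
  trans (sym (+-suc (dWeight (input s ∷ᵥ dstack s)) (length I)))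
        (cong (λ J → dWeight (input s ∷ᵥ dstack s) + length J) (sym I≡))

step-weight : ∀ {k} {s s' : State k} → StepCase s s' → suc (weight s') ≡ weight s
step-weight {s = s} (emitSmallest I≡ _) = emit-weight s I≡
step-weight {s = s} (emitForced I≡ _ _ _) = emit-weight s I≡
step-weight {s = s} (shift st) = innerStep-weight (deeper {D = input s} st)
step-weight {s = s} (read {inp = inp} inp≡ _ _ st) =
  subst (λ L → _ ≡ dWeight (L ∷ᵥ dstack s) + length (istack s)) (sym inp≡)
        (innerStep-weight (innerStep-extend inp st))

step-sorted : ∀ {k} {s s' : State k} → StacksSorted s → StepCase s s' → StacksSorted s'
step-sorted (sD , inc) (emitSmallest I≡ _) with subst Increasing I≡ inc
... | _ ∷ inc' = sD , inc'
step-sorted (sD , inc) (emitForced I≡ _ _ _) with subst Increasing I≡ inc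
... | _ ∷ inc' = sD , inc'
step-sorted (sD , inc) (shift st) =
  innerStep-sorted st sD , Advance-increasing (innerStep-advance st sD) inc
step-sorted (sD , inc) (read _ _ _ st) with innerStep-sorted st (([] ∷ []) VAll.∷ sD)
... | _ VAll.∷ sD' = sD' , Advance-increasing (innerStep-advance st (([] ∷ []) VAll.∷ sD)) inc

data Progress {k} (s : State k) : State k → Set where
  emitted  : ∀ {x I} → istack s ≡ x ∷ I →
             Progress s ⟨ input s , dstack s , I , output s ++ [ x ] ⟩
  advanced : ∀ {s'} → output s' ≡ output s →
             Advance (upstream s) (istack s) (upstream s') (istack s') → Progress s s'

shift-upstream : ∀ {k} (s : State k) {ds' I'} → DSorted (dstack s) →
                 InnerStep (dstack s) (istack s) ds' I' →
                 Advance (upstream s) (istack s) (upstream ⟨ input s , ds' , I' , output s ⟩) I'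
shift-upstream s sD st = Advance-++ (input s) (innerStep-advance st sD)

read-upstream : ∀ {k} (s : State k) {x inp ds' I'} → DSorted (dstack s) → input s ≡ x ∷ inp →
                InnerStep ([ x ] ∷ᵥ dstack s) (istack s) ([] ∷ᵥ ds') I' →
                Advance (upstream s) (istack s) (upstream ⟨ inp , ds' , I' , output s ⟩) I'
read-upstream s {x} {inp} {ds'} sD inp≡ st =
  subst₂ (λ F F' → Advance F (istack s) F' _)
         (trans (List.++-assoc (dContents (dstack s)) [ x ] inp) (cong (dContents (dstack s) ++_) (sym inp≡)))
         (cong (_++ inp) (List.++-identityʳ (dContents ds')))
         (Advance-++ inp (innerStep-advance st (([] ∷ []) VAll.∷ sD)))

progress : ∀ {k} {s s' : State k} → StacksSorted s → StepCase s s' → Progress s s'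
progress _ (emitSmallest I≡ _) = emitted I≡
progress _ (emitForced I≡ _ _ _) = emitted I≡
progress {s = s} (sD , _) (shift st) = advanced refl (shift-upstream s sD st)
progress {s = s} (sD , _) (read inp≡ _ _ st) = advanced refl (read-upstream s sD inp≡ st)

remaining-emit : ∀ {k} (s : State k) {x I} → istack s ≡ x ∷ I →
                 remaining s ↭ x ∷ remaining ⟨ input s , dstack s , I , output s ⟩
remaining-emit ⟨ inp , ds , _ , _ ⟩ {x} {I} refl =
  ↭-trans (↭-sym (Perm.++-assoc inp (concat (toList ds)) (x ∷ I)))
    (↭-trans (Perm.shift x (inp ++ concat (toList ds)) I)
             (↭-prep x (Perm.++-assoc inp (concat (toList ds)) I)))

remaining-advance : ∀ {k} (s s' : State k) → Advance (upstream s) (istack s) (upstream s') (istack s') →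
                    remaining s' ↭ remaining s
remaining-advance s s' adv =
  ↭-trans (remaining-split s') (↭-trans (Advance-perm adv) (↭-sym (remaining-split s)))

Run : ∀ {k} → State k → State k → Set
Run = Star Step

sorted-run : ∀ {k} {s s' : State k} → StacksSorted s → Run s s' → StacksSorted s'
sorted-run sorted ε = sorted
sorted-run {s = s} sorted (st ◅ run) = sorted-run (step-sorted sorted (decode s st)) run

-- The procedure always halts, since the weight decreases at every step.
halts-within : ∀ {k} n (s : State k) → weight s < n → Σ (State k) λ f → Run s f × step f ≡ nothing
halts-within (suc n) s w<n with step s in st
... | nothing = s , ε , st
... | just s' with halts-within n s' (subst (_≤ n) (sym (step-weight (decode s st))) (s≤s⁻¹ w<n))
...   | f , run , halt = f , st ◅ run , halt

terminates : ∀ {k} (s : State k) → Σ (State k) λ f → Run s f × step f ≡ nothing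
terminates s = halts-within (suc (weight s)) s (n<1+n _)

noStacks : ∀ k → Vec (List ℕ) k
noStacks k = replicate k []

noStacks-sorted : ∀ k → DSorted (noStacks k)
noStacks-sorted zero = VAll.[]
noStacks-sorted (suc k) = [] VAll.∷ noStacks-sorted k

noStacks-contents : ∀ k → dContents (noStacks k) ≡ []
noStacks-contents zero = refl
noStacks-contents (suc k) = trans (List.++-identityʳ _) (noStacks-contents k)

noStacks-concat : ∀ k → concat (toList (noStacks k)) ≡ []
noStacks-concat zero = refl
noStacks-concat (suc k) = noStacks-concat k

initial-sorted : ∀ k π → StacksSorted (initial k π)
initial-sorted k π = noStacks-sorted k , []

remaining-initial : ∀ k π → remaining (initial k π) ≡ π
remaining-initial k π = trans (cong (λ L → π ++ L ++ []) (noStacks-concat k)) (List.++-identityʳ π)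

output-grows : ∀ {k} {s f : State k} → StacksSorted s → Run s f →
               Σ (List ℕ) λ Δ → output f ≡ output s ++ Δ
output-grows {s = s} sorted ε = [] , sym (List.++-identityʳ (output s))
output-grows {s = s} sorted (st ◅ run) with progress sorted (decode s st)
... | emitted {x} _ with output-grows (step-sorted sorted (decode s st)) run
...   | Δ , f≡ = x ∷ Δ , trans f≡ (List.++-assoc (output s) [ x ] Δ)
output-grows {s = s} sorted (st ◅ run) | advanced o≡ _
  with output-grows (step-sorted sorted (decode s st)) run
...   | Δ , f≡ = Δ , trans f≡ (cong (_++ Δ) o≡)

eventually-output : ∀ {k} {s f : State k} {y} → StacksSorted s → Run s f → step f ≡ nothing →
                    y ∈ remaining s → Σ (List ℕ) λ Δ → output f ≡ output s ++ Δ × y ∈ Δ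
eventually-output {f = f} sorted ε halt y∈ with () ← Perm.∈-resp-↭ (halted-empty f halt) y∈
eventually-output {s = s} sorted (st ◅ run) halt y∈ with progress sorted (decode s st)
... | emitted {x} I≡ with Perm.∈-resp-↭ (remaining-emit s I≡) y∈
...   | here refl with output-grows (step-sorted sorted (decode s st)) run
...     | Δ , f≡ = x ∷ Δ , trans f≡ (List.++-assoc (output s) [ x ] Δ) , here refl
eventually-output {s = s} sorted (st ◅ run) halt y∈ | emitted {x} I≡ | there y∈'
  with eventually-output (step-sorted sorted (decode s st)) run halt y∈'
...     | Δ , f≡ , y∈Δ = x ∷ Δ , trans f≡ (List.++-assoc (output s) [ x ] Δ) , there y∈Δ
eventually-output {s = s} sorted (_◅_ {j = s'} st run) halt y∈ | advanced o≡ adv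
  with eventually-output (step-sorted sorted (decode s st)) run halt
         (Perm.∈-resp-↭ (↭-sym (remaining-advance s s' adv)) y∈)
...   | Δ , f≡ , y∈Δ = Δ , trans f≡ (cong (_++ Δ) o≡) , y∈Δ

output-below-remaining : ∀ {k} {s f : State k} {y z} → StacksSorted s → Run s f → step f ≡ nothing →
                         AllPairs _<_ (output f) → y ∈ output s → z ∈ remaining s → y < z
output-below-remaining {s = s} sorted run halt inc y∈ z∈ with eventually-output sorted run halt z∈
... | Δ , f≡ , z∈Δ = AllPairs-across (output s) (subst (AllPairs _<_) f≡ inc) y∈ z∈Δ

present-run : ∀ {k} {s s' : State k} {y} → StacksSorted s → Run s s' →
              y ∈ output s ++ remaining s → y ∈ output s' ++ remaining s'
present-run sorted ε y∈ = y∈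
present-run {s = s} sorted (st ◅ run) y∈ =
  present-run (step-sorted sorted case) run (present-step (progress sorted case) y∈)
  where
  case = decode s st
  present-step : ∀ {s' y} → Progress s s' → y ∈ output s ++ remaining s →
                 y ∈ output s' ++ remaining s'
  present-step (emitted {x} I≡) y∈ with ∈-++⁻ (output s) y∈
  ... | inj₁ y∈out = ∈-++⁺ˡ (∈-++⁺ˡ {ys = [ x ]} y∈out)
  ... | inj₂ y∈rem with Perm.∈-resp-↭ (remaining-emit s I≡) y∈rem
  ...   | here refl = ∈-++⁺ˡ (∈-++⁺ʳ (output s) (here refl))
  ...   | there y∈rem' = ∈-++⁺ʳ (output s ++ [ x ]) y∈rem'
  present-step {s'} (advanced o≡ adv) y∈ with ∈-++⁻ (output s) y∈
  ... | inj₁ y∈out = ∈-++⁺ˡ (subst (λ O → _ ∈ O) (sym o≡) y∈out)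
  ... | inj₂ y∈rem =
    ∈-++⁺ʳ (output s') (Perm.∈-resp-↭ (↭-sym (remaining-advance s s' adv)) y∈rem)

block-step : ∀ {k} {s s' : State k} → StacksSorted s → StepCase s s' → Block s →
             Block s' ⊎ Σ ℕ λ a → Σ ℕ λ c →
                          output s' ≡ output s ++ [ a ] × c ∈ remaining s' × c < a
block-step {s = s} sorted case (block a∈I bc c<a a≤b) with progress sorted case
... | advanced _ adv with Advance-block (proj₂ sorted) adv a∈I bc c<a a≤b
...   | a∈I' , bc' = inj₁ (block a∈I' bc' c<a a≤b)
block-step {s = s} sorted case (block {a} {b} {c} a∈I bc c<a a≤b) | emitted {I = I} I≡
  with subst (a ∈_) I≡ a∈I
... | there a∈I' = inj₁ (block a∈I' bc c<a a≤b)
... | here refl = inj₂ (a , c , refl , c∈remaining , c<a)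
  where
  c∈remaining : c ∈ remaining ⟨ input s , dstack s , I , output s ⟩
  c∈remaining = Perm.∈-resp-↭ (↭-sym (remaining-split ⟨ input s , dstack s , I , output s ⟩))
                              (∈-++⁺ˡ (Before-∈ʳ bc))

block-doom : ∀ {k} {s f : State k} → StacksSorted s → Run s f → step f ≡ nothing →
             AllPairs _<_ (output f) → Block s → ⊥
block-doom {f = f} _ ε halt _ (block {a} a∈I _ _ _) with () ← subst (a ∈_) (proj₂ (halted f halt)) a∈I
block-doom {s = s} sorted (st ◅ run) halt inc blk with block-step sorted (decode s st) blk
... | inj₁ blk' = block-doom (step-sorted sorted (decode s st)) run halt inc blk'
... | inj₂ (a , c , o≡ , c∈ , c<a) =
  <-asym c<a (output-below-remaining (step-sorted sorted (decode s st)) run halt inc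
                (subst (a ∈_) (sym o≡) (∈-++⁺ʳ (output s) (here refl))) c∈)

record ReadOf {k} (b : ℕ) (post : List ℕ) (s f : State k) : Set where
  constructor readOf
  field
    state   : State k
    before  : Run s state
    after   : Run state f
    input≡  : input state ≡ b ∷ post
    noInner : innerMove (dstack state) (istack state) ≡ nothing
    notTop  : NotSmallTop state

ReadOf-◅ : ∀ {k b post} {s s' f : State k} → Step s s' → ReadOf b post s' f → ReadOf b post s f
ReadOf-◅ st (readOf s₁ r₁ r₂ i m n) = readOf s₁ (st ◅ r₁) r₂ i m n

find-read : ∀ {k} X {b post} {s f : State k} → Run s f → input s ≡ X ++ b ∷ post → input f ≡ [] →
            ReadOf b post s f
find-read X {b} {post} ε inp≡ done with () ← List.++-conicalʳ X (b ∷ post) (trans (sym inp≡) done)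
find-read X {s = s} (st ◅ run) inp≡ done with decode s st
... | emitSmallest _ _ = ReadOf-◅ st (find-read X run inp≡ done)
... | emitForced _ _ _ _ = ReadOf-◅ st (find-read X run inp≡ done)
... | shift _ = ReadOf-◅ st (find-read X run inp≡ done)
... | read inp≡' im nst _ with X
...   | [] = readOf s ε (st ◅ run) inp≡ im nst
...   | y ∷ X' = ReadOf-◅ st (find-read X' run (List.∷-injectiveʳ (trans (sym inp≡') inp≡)) done)

-- Sorting implies avoidance: for a 231 pattern a ... b ... c, the state in
-- which b is read contains a block, which dooms the run.
sorted⇒avoids : ∀ {k n π} → π ↭ applyUpTo suc n → SortedLG k π → Avoids231 π
sorted⇒avoids {k} {n} {π} π↭ (f , run , halt , out≡) c231 with occurrence231 π c231
... | occurrence A post a b c π≡ a∈A c∈post c<a a<b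
  with find-read A run π≡ (List.++-conicalʳ (dContents (dstack f)) (input f) (proj₁ (halted f halt)))
... | readOf s₁ run₁ run₂ inp₁ im nst = block-doom sorted₁ run₂ halt increasing blk
  where
  sorted₁ : StacksSorted s₁
  sorted₁ = sorted-run (initial-sorted k π) run₁

  increasing : AllPairs _<_ (output f)
  increasing = subst (AllPairs _<_) (sym out≡) (ascending (length π))

  c∈rem : c ∈ remaining s₁
  c∈rem = ∈-++⁺ˡ (subst (c ∈_) (sym inp₁) (there c∈post))

  a∈ : a ∈ output s₁ ++ remaining s₁
  a∈ = present-run (initial-sorted k π) run₁
         (subst (a ∈_) (sym (trans (remaining-initial k π) π≡)) (∈-++⁺ˡ a∈A))

  -- a is not output yet (c is not), not in the input (it precedes b),
  -- so it is in I or in the D stacks.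
  blk : Block s₁
  blk with ∈-++⁻ (output s₁) a∈
  ... | inj₁ a∈out =
    ⊥-elim (<-asym c<a (output-below-remaining sorted₁ run₂ halt increasing a∈out c∈rem))
  ... | inj₂ a∈rem with ∈-++⁻ (upstream s₁) (Perm.∈-resp-↭ (remaining-split s₁) a∈rem)
  ...   | inj₂ a∈I =
    block a∈I (subst (λ L → Before b c (dContents (dstack s₁) ++ L)) (sym inp₁)
                     (Before-prefix (dContents (dstack s₁)) (atHead c∈post)))
          c<a (<⇒≤ a<b)
  ...   | inj₁ a∈up with ∈-++⁻ (dContents (dstack s₁)) a∈up
  ...     | inj₂ a∈inp with subst (a ∈_) inp₁ a∈inp
  ...       | here refl = ⊥-elim (<-irrefl refl a<b)
  ...       | there a∈post =
    ⊥-elim (Unique-disjoint A (subst Unique π≡ (permutation-unique π↭)) a∈A (there a∈post))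
  blk | inj₂ a∈rem | inj₁ a∈up | inj₁ a∈D with jammed-block s₁ sorted₁ nst im
  ...       | inj₂ blk₁ = blk₁
  ...       | inj₁ empty with () ← subst (a ∈_) empty a∈D

-- Throughout the run on a 231-avoiding π, the
-- D stacks hold at most one element, every element of I was read before
-- everything upstream, and the output is an initial segment of 1 ... n.
module AvoidingRun {k n : ℕ} {π : List ℕ} (π↭ : π ↭ applyUpTo suc n) (avoid : Avoids231 π) where

  N : List ℕ
  N = applyUpTo suc n

  Settled : State k → Set
  Settled s = Σ (List ℕ) λ P → π ≡ P ++ upstream s × istack s ⊆ P

  Pending : State k → Set
  Pending s = Σ (List ℕ) λ L → N ≡ output s ++ L × remaining s ↭ L

  record Invariant (s : State k) : Set where
    field
      sorted  : StacksSorted s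
      short   : length (dContents (dstack s)) ≤ 1
      settled : Settled s
      pending : Pending s
  open Invariant

  -- Blocks would exhibit a 231 pattern.
  no-block : ∀ {s} → Settled s → Block s → ⊥
  no-block {s} (P , π≡ , I⊆P) (block {a} {b} a∈I bc c<a a≤b) =
    avoid (subst Contains231 (sym π≡) (pattern231 P (I⊆P a∈I) bc c<a a<b))
    where
    a≢b : a ≢ b
    a≢b refl = Unique-disjoint P (subst Unique π≡ (permutation-unique π↭)) (I⊆P a∈I) (Before-∈ˡ bc)
    a<b = ≤∧≢⇒< a≤b a≢b

  Settled-emit : ∀ {s x I} → istack s ≡ x ∷ I → Settled s →
                 Settled ⟨ input s , dstack s , I , output s ++ [ x ] ⟩
  Settled-emit I≡ (P , π≡ , I⊆P) = P , π≡ , λ a∈I → I⊆P (subst (_ ∈_) (sym I≡) (there a∈I))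

  Settled-simple : ∀ {s s'} → Simple (upstream s) (istack s) (upstream s') (istack s') →
                   Settled s → Settled s'
  Settled-simple (inj₁ (up≡ , I≡)) (P , π≡ , I⊆P) =
    P , trans π≡ (cong (P ++_) (sym up≡)) , λ a∈I → I⊆P (subst (_ ∈_) I≡ a∈I)
  Settled-simple {s' = s'} (inj₂ (x , up≡ , I≡)) (P , π≡ , I⊆P) =
    P ++ [ x ] , trans π≡ (trans (cong (P ++_) up≡) (sym (List.++-assoc P [ x ] (upstream s')))) , I'⊆
    where
    I'⊆ : istack s' ⊆ P ++ [ x ]
    I'⊆ a∈I' with subst (_ ∈_) I≡ a∈I'
    ... | here refl = ∈-++⁺ʳ P (here refl)
    ... | there a∈I = ∈-++⁺ˡ (I⊆P a∈I)

  -- Only the smallest remaining element is output, and it heads the complement.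
  Pending-emit : ∀ {s x I} → istack s ≡ x ∷ I → isSmallest x s ≡ true → Pending s →
                 Pending ⟨ input s , dstack s , I , output s ++ [ x ] ⟩
  Pending-emit {s} {x} I≡ smallest (L , N≡ , rem↭L)
    with least-head (AllPairs-suffix (output s) (subst (AllPairs _<_) N≡ (ascending n)))
                    (Perm.∈-resp-↭ rem↭L (Perm.∈-resp-↭ (↭-sym (remaining-emit s I≡)) (here refl)))
                    (Perm.All-resp-↭ rem↭L (isSmallest-true s smallest))
  ... | L' , refl = L' , trans N≡ (sym (List.++-assoc (output s) [ x ] L')) ,
                    Perm.drop-∷ (↭-trans (↭-sym (remaining-emit s I≡)) rem↭L)

  Pending-keep : ∀ {s s'} → output s' ≡ output s → remaining s' ↭ remaining s →
                 Pending s → Pending s'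
  Pending-keep o≡ rem≡ (L , N≡ , rem↭L) =
    L , trans N≡ (cong (_++ L) (sym o≡)) , ↭-trans rem≡ rem↭L

  invariant-step : ∀ {s s'} → Invariant s → StepCase s s' → Invariant s'
  invariant-step {s} inv case@(emitSmallest I≡ smallest) = record
    { sorted = step-sorted (sorted inv) case
    ; short = short inv
    ; settled = Settled-emit {s} I≡ (settled inv)
    ; pending = Pending-emit {s} I≡ smallest (pending inv) }
  invariant-step {s} inv (emitForced I≡ notSmall im noRead) =
    ⊥-elim (no-block (settled inv) (forced-block s (sorted inv) I≡ notSmall im noRead))
  invariant-step {s} {s'} inv case@(shift st) = record
    { sorted = step-sorted (sorted inv) case
    ; short = Simple-short (short inv) simple
    ; settled = Settled-simple {s} {s'} (Simple-++ (input s) simple) (settled inv)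
    ; pending = Pending-keep {s} {s'} refl (remaining-advance s s' (shift-upstream s sD st)) (pending inv) }
    where
    sD = proj₁ (sorted inv)
    simple = shift-simple sD (short inv) st
  invariant-step {s} {s'} inv case@(read {inp = inp} inp≡ im nst st) with jammed-block s (sorted inv) nst im
  ... | inj₂ blk = ⊥-elim (no-block (settled inv) blk)
  ... | inj₁ empty = record
    { sorted = step-sorted (sorted inv) case
    ; short = Simple-short (s≤s z≤n) simple
    ; settled = Settled-simple {s} {s'} upstream-simple (settled inv)
    ; pending = Pending-keep {s} {s'} refl (remaining-advance s s' (read-upstream s sD inp≡ st)) (pending inv) }
    where
    sD = proj₁ (sorted inv)
    simple = read-simple sD empty st
    upstream-simple : Simple (upstream s) (istack s) (upstream s') (istack s')
    upstream-simple =
      subst (λ F → Simple F _ _ _) (cong₂ _++_ (sym empty) (sym inp≡)) (Simple-++ inp simple)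

  invariant-run : ∀ {s f} → Invariant s → Run s f → Invariant f
  invariant-run inv ε = inv
  invariant-run {s} inv (st ◅ run) = invariant-run (invariant-step inv (decode s st)) run

  initial-invariant : Invariant (initial k π)
  initial-invariant = record
    { sorted = initial-sorted k π
    ; short = subst (λ F → length F ≤ 1) (sym (noStacks-contents k)) z≤n
    ; settled = [] , sym (cong (_++ π) (noStacks-contents k)) , λ ()
    ; pending = N , refl , subst (_↭ N) (sym (remaining-initial k π)) π↭ }

  final-output : ∀ {f} → Pending f → step f ≡ nothing → output f ≡ N
  final-output {f} (L , N≡ , rem↭L) halt
    with Perm.↭-empty-inv (↭-trans (↭-sym rem↭L) (halted-empty f halt))
  ... | refl = sym (trans N≡ (List.++-identityʳ (output f)))

  sorts : SortedLG k π
  sorts with terminates (initial k π)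
  ... | f , run , halt =
    f , run , halt ,
    trans (final-output {f} (pending (invariant-run initial-invariant run)) halt)
          (cong (applyUpTo suc) (sym length≡))
    where
    length≡ : length π ≡ n
    length≡ = trans (Perm.↭-length π↭) (List.length-applyUpTo suc n)

proposition4 : (k n : ℕ) (π : List ℕ) → π ↭ applyUpTo suc n →
    (SortedLG k π ⇔ Avoids231 π)
proposition4 k n π π↭ = mk⇔ (sorted⇒avoids π↭) (AvoidingRun.sorts {k} π↭)
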